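{- Let $n\geq 3$ be odd. The word $\mathbf{w}_n$ is an isoterm for the monoid variety $\mathbb{B}_2^1\cap[\![x^2y\approx yx^2]\!]$.
   Context: $\mathbb{B}_2^1$ is the monoid variety generated by ${\bf B}_2^1=\langle \mathsf{a},\mathsf{b}\mid \mathsf{a}\mathsf{b}\mathsf{a}=\mathsf{a},\ \mathsf{b}\mathsf{a}\mathsf{b}=\mathsf{b},\ \mathsf{a}\mathsf{a}=\mathsf{b}\mathsf{b}=0\rangle$, and $[\![x^2y\approx yx^2]\!]$ is the monoid variety defined by that identity. For distinct letters $x_1,\dots,x_n,y,z$, $\mathbf{w}_n=x_1s_1x_2s_2\cdots x_ns_nx_1s_{n+1}\cdots s_{2n-1}x_n$ with $s_i=y$ for odd $i$, $s_i=z$ for even $i$ (i.e. $x_1yx_2z\cdots x_nyx_1zx_2y\cdots yx_n$). A word $\mathbf{w}$ is an isoterm for a variety if every identity $\mathbf{w}\approx\mathbf{w}'$ holding in it has $\mathbf{w}'=\mathbf{w}$. -}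

module Defs where

open import Level using (0ℓ)
open import Data.Nat using (ℕ; zero; suc; _+_; _*_; _∸_; _≤ᵇ_)
open import Data.Bool using (Bool; true; false; if_then_else_)
open import Data.List using (List; []; _∷_; _++_; foldr; concat; map; applyUpTo)
open import Data.Product using (_×_; ∃)
open import Relation.Binary.PropositionalEquality using (_≡_)
open import Algebra.Bundles using (Monoid)

Word : Set
Word = List ℕ

-- The monoid B₂¹ = {1, 0, a, b, ab, ba} with aba = a, bab = b, aa = bb = 0.

data B21 : Set where
  one zer a b ab ba : B21

_·_ : B21 → B21 → B21
one · y   = y
x   · one = x
zer · _   = zer
_   · zer = zer
a   · a   = zer
a   · b   = ab
a   · ab  = zer
a   · ba  = a
b   · a   = ba
b   · b   = zer
b   · ab  = b
b   · ba  = zer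
ab  · a   = a
ab  · b   = zer
ab  · ab  = ab
ab  · ba  = zer
ba  · a   = zer
ba  · b   = b
ba  · ab  = zer
ba  · ba  = ba

evalB : (ℕ → B21) → Word → B21
evalB φ = foldr (λ x r → φ x · r) one

B21⊨ : Word → Word → Set
B21⊨ u v = ∀ (φ : ℕ → B21) → evalB φ u ≡ evalB φ v

module _ (M : Monoid 0ℓ 0ℓ) where
  open Monoid M
  evalM : (ℕ → Carrier) → Word → Carrier
  evalM φ = foldr (λ x r → φ x ∙ r) ε

  _⊨_≈ᵢ_ : Word → Word → Set
  _⊨_≈ᵢ_ u v = ∀ (φ : ℕ → Carrier) → evalM φ u ≈ evalM φ v

-- Membership in the monoid variety 𝔹₂¹ ∩ [[x²y ≈ yx²]]:
-- M satisfies every identity of B₂¹, and the identity x²y ≈ yx²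
-- (x = letter 0, y = letter 1).
InVariety : Monoid 0ℓ 0ℓ → Set
InVariety M =
  (∀ (u v : Word) → B21⊨ u v → M ⊨ u ≈ᵢ v)
  × (M ⊨ (0 ∷ 0 ∷ 1 ∷ []) ≈ᵢ (1 ∷ 0 ∷ 0 ∷ []))

IsIsoterm : Word → Set₁
IsIsoterm w = ∀ (w' : Word) → (∀ (M : Monoid 0ℓ 0ℓ) → InVariety M → M ⊨ w ≈ᵢ w') → w' ≡ w

yL zL : ℕ
yL = 0
zL = 1

xL : ℕ → ℕ
xL i = suc i

odd? : ℕ → Bool
odd? zero = false
odd? (suc k) with odd? k
... | true  = false
... | false = true

sL : ℕ → ℕ
sL k = if odd? k then yL else zL

-- w_n = x_1 s_1 x_2 s_2 ⋯ x_n s_n x_1 s_{n+1} ⋯ x_{n-1} s_{2n-1} x_n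
-- the k-th block (1 ≤ k ≤ 2n-1) is x_{idx k} s_k with idx k = k if k ≤ n, else k - n.
wn : ℕ → Word
wn n = concat (map block (applyUpTo suc (2 * n ∸ 1))) ++ (xL n ∷ [])
  where
  block : ℕ → Word
  block k = xL (if k ≤ᵇ n then k else k ∸ n) ∷ sL k ∷ []

Odd : ℕ → Set
Odd n = ∃ λ k → n ≡ suc (2 * k)

{-# OPTIONS --safe #-}
module Submission where

-- Evaluate a word v
-- with the same values as w_n under a family of substitutions ("tests") into
-- B₂¹, each sending some letters to a and some to b. Along w_n the letters a
-- test sees alternate between a and b, so its value stays ba or b; at each
-- position every letter other than the next letter of w_n drives some test
-- to 0, and before the end some test has not reached its final value. The
-- tests separate x-letters from y, z; y from z; and each cyclically
-- consecutive pair x_i, x_{i+1}. The pair x_n, x_1 also sends z to ab, which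
-- forbids z at the end; since n is odd, it never forbids a z inside w_n.
--
-- To pass to the variety, identify two words when they occur in exactly the
-- same contexts p _ s of W = w_n. As W is an isoterm for B₂¹, this syntactic
-- monoid satisfies every identity of B₂¹. As B₂¹ ⊨ x²y ≈ x³y, W has no
-- square factor, so all words containing a square are identified and
-- x²y ≈ yx² holds as well. An identity W ≈ w′ of the variety therefore holds
-- in this monoid, and evaluating it at the identity substitution gives w′ = W.

open import Level using (0ℓ)
open import Defs
open import Data.Nat using (ℕ; zero; suc; _+_; _*_; _∸_; _≤_; _<_; _%_; pred; NonZero; z≤n; s≤s; _≤ᵇ_)
open import Data.Nat.Properties
open import Data.Nat.DivMod using (%-distribˡ-+; [m+n]%n≡m%n; m<n⇒m%n≡m; m%n%n≡m%n; n%n≡0; m*n%n≡0; m%n<n)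
open import Data.Bool using (Bool; true; false; not; if_then_else_)
open import Data.Bool.Properties using (not-involutive)
open import Data.List using (List; []; _∷_; _++_; foldr; [_]; concat; map; applyUpTo)
open import Data.List.Properties using (++-assoc; ++-identityʳ; ++-identityˡ-unique; ++-cancelˡ)
open import Data.List.Membership.Propositional using (_∈_)
open import Data.List.Relation.Unary.Any using (here; there)
open import Data.List.Relation.Unary.All using (all?; lookup; tabulate)
open import Data.Product using (_×_; _,_; ∃; map₂)
open import Data.Sum using (_⊎_; inj₁; inj₂) renaming (map₂ to ⊎-map₂)
open import Data.Empty using (⊥-elim)
open import Function using (_∘_)
open import Function.Bundles using (_⇔_; mk⇔; Equivalence)
open import Function.Properties.Equivalence using (⇔-setoid)
  renaming (refl to ⇔-refl; sym to ⇔-sym; trans to ⇔-trans)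
open import Relation.Nullary using (¬_; Dec; yes; no; map′; from-yes; contradiction)
open import Relation.Nullary.Reflects using (ofʸ; ofⁿ)
open import Relation.Unary using (Decidable)
open import Relation.Binary.Definitions using (DecidableEquality)
open import Relation.Binary.PropositionalEquality
  using (_≡_; _≢_; ≢-sym; refl; sym; trans; cong; cong₂; subst; module ≡-Reasoning)
open import Algebra.Bundles using (Monoid)

index : B21 → ℕ
index one = 0
index zer = 1
index a   = 2
index b   = 3
index ab  = 4
index ba  = 5

index-injective : ∀ {x y} → index x ≡ index y → x ≡ y
index-injective {one} {one} _ = refl
index-injective {zer} {zer} _ = refl
index-injective {a}   {a}   _ = refl
index-injective {b}   {b}   _ = refl
index-injective {ab}  {ab}  _ = refl
index-injective {ba}  {ba}  _ = refl

infix 4 _≟ᴮ_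
_≟ᴮ_ : DecidableEquality B21
x ≟ᴮ y = map′ index-injective (cong index) (index x ≟ index y)

elements : List B21
elements = one ∷ zer ∷ a ∷ b ∷ ab ∷ ba ∷ []

∈-elements : ∀ x → x ∈ elements
∈-elements one = here refl
∈-elements zer = there (here refl)
∈-elements a   = there (there (here refl))
∈-elements b   = there (there (there (here refl)))
∈-elements ab  = there (there (there (there (here refl))))
∈-elements ba  = there (there (there (there (there (here refl)))))

∀ᴮ? : {P : B21 → Set} → Decidable P → Dec (∀ x → P x)
∀ᴮ? P? = map′ (λ all x → lookup all (∈-elements x)) (λ h → tabulate (λ {x} _ → h x)) (all? P? elements)

·-assoc : ∀ x y z → (x · y) · z ≡ x · (y · z)
·-assoc = from-yes (∀ᴮ? λ x → ∀ᴮ? λ y → ∀ᴮ? λ z → (x · y) · z ≟ᴮ x · (y · z))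

·-identityʳ : ∀ x → x · one ≡ x
·-identityʳ = from-yes (∀ᴮ? λ x → x · one ≟ᴮ x)

·-zeroˡ : ∀ x → zer · x ≡ zer
·-zeroˡ = from-yes (∀ᴮ? λ x → zer · x ≟ᴮ zer)

square≡cube : ∀ x y → x · (x · y) ≡ x · (x · (x · y))
square≡cube = from-yes (∀ᴮ? λ x → ∀ᴮ? λ y → x · (x · y) ≟ᴮ x · (x · (x · y)))

zer-propagates : ∀ {x y} → x · y ≡ zer → ∀ z → x · (y · z) ≡ zer
zer-propagates {x} {y} xy≡0 z = begin
  x · (y · z) ≡⟨ ·-assoc x y z ⟨
  (x · y) · z ≡⟨ cong (_· z) xy≡0 ⟩
  zer · z     ≡⟨ ·-zeroˡ z ⟩
  zer         ∎
  where open ≡-Reasoning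

evalB-++ : ∀ φ u v → evalB φ (u ++ v) ≡ evalB φ u · evalB φ v
evalB-++ φ []      v = refl
evalB-++ φ (x ∷ u) v = begin
  φ x · evalB φ (u ++ v)           ≡⟨ cong (φ x ·_) (evalB-++ φ u v) ⟩
  φ x · (evalB φ u · evalB φ v)    ≡⟨ ·-assoc (φ x) (evalB φ u) (evalB φ v) ⟨
  (φ x · evalB φ u) · evalB φ v    ∎
  where open ≡-Reasoning

B21⊨-++ : ∀ {u u′ v v′} → B21⊨ u u′ → B21⊨ v v′ → B21⊨ (u ++ v) (u′ ++ v′)
B21⊨-++ {u} {u′} {v} {v′} u≈u′ v≈v′ φ = begin
  evalB φ (u ++ v)           ≡⟨ evalB-++ φ u v ⟩
  evalB φ u · evalB φ v      ≡⟨ cong₂ _·_ (u≈u′ φ) (v≈v′ φ) ⟩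
  evalB φ u′ · evalB φ v′    ≡⟨ evalB-++ φ u′ v′ ⟨
  evalB φ (u′ ++ v′)         ∎
  where open ≡-Reasoning

substitute : (ℕ → Word) → Word → Word
substitute θ = foldr (λ x r → θ x ++ r) []

substitute-[_] : ∀ u → substitute [_] u ≡ u
substitute-[ [] ]    = refl
substitute-[ x ∷ u ] = cong (x ∷_) substitute-[ u ]

evalB-substitute : ∀ ψ θ u → evalB ψ (substitute θ u) ≡ evalB (evalB ψ ∘ θ) u
evalB-substitute ψ θ []      = refl
evalB-substitute ψ θ (x ∷ u) =
  trans (evalB-++ ψ (θ x) (substitute θ u)) (cong (evalB ψ (θ x) ·_) (evalB-substitute ψ θ u))

B21⊨-substitute : ∀ {u v} → B21⊨ u v → ∀ θ → B21⊨ (substitute θ u) (substitute θ v)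
B21⊨-substitute {u} {v} u≈v θ ψ = begin
  evalB ψ (substitute θ u)   ≡⟨ evalB-substitute ψ θ u ⟩
  evalB (evalB ψ ∘ θ) u      ≡⟨ u≈v (evalB ψ ∘ θ) ⟩
  evalB (evalB ψ ∘ θ) v      ≡⟨ evalB-substitute ψ θ v ⟨
  evalB ψ (substitute θ v)   ∎
  where open ≡-Reasoning

B21⊨-square≈cube : ∀ u s → B21⊨ (u ++ u ++ s) (u ++ u ++ u ++ s)
B21⊨-square≈cube u s ψ = begin
  evalB ψ (u ++ u ++ s)        ≡⟨ unfold u s ⟩
  U · (U · S)                  ≡⟨ square≡cube U S ⟩
  U · (U · (U · S))            ≡⟨ cong (λ x → U · (U · x)) (evalB-++ ψ u s) ⟨
  U · (U · evalB ψ (u ++ s))   ≡⟨ unfold u (u ++ s) ⟨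
  evalB ψ (u ++ u ++ u ++ s)   ∎
  where
  open ≡-Reasoning
  U = evalB ψ u
  S = evalB ψ s
  unfold : ∀ v t → evalB ψ (u ++ v ++ t) ≡ U · (evalB ψ v · evalB ψ t)
  unfold v t = trans (evalB-++ ψ u (v ++ t)) (cong (U ·_) (evalB-++ ψ v t))

IsB21Isoterm : Word → Set
IsB21Isoterm w = ∀ v → B21⊨ w v → v ≡ w

module Syntactic (W : Word) (W-isoterm : IsB21Isoterm W) where

  infix 4 _≈ᵂ_
  _≈ᵂ_ : Word → Word → Set
  u ≈ᵂ v = ∀ p s → (p ++ u ++ s ≡ W) ⇔ (p ++ v ++ s ≡ W)

  ≡⇒≈ᵂ : ∀ {u v} → u ≡ v → u ≈ᵂ v
  ≡⇒≈ᵂ refl p s = ⇔-refl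

  ++-cong : ∀ {u u′ v v′} → u ≈ᵂ u′ → v ≈ᵂ v′ → u ++ v ≈ᵂ u′ ++ v′
  ++-cong {u} {u′} {v} {v′} u≈u′ v≈v′ p s = begin
    (p ++ (u ++ v) ++ s ≡ W)       ≡⟨ cong (λ x → p ++ x ≡ W) (++-assoc u v s) ⟩
    (p ++ u ++ v ++ s ≡ W)         ≈⟨ u≈u′ p (v ++ s) ⟩
    (p ++ u′ ++ v ++ s ≡ W)        ≡⟨ cong (_≡ W) (++-assoc p u′ (v ++ s)) ⟨
    ((p ++ u′) ++ v ++ s ≡ W)      ≈⟨ v≈v′ (p ++ u′) s ⟩
    ((p ++ u′) ++ v′ ++ s ≡ W)     ≡⟨ cong (_≡ W) (++-assoc p u′ (v′ ++ s)) ⟩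
    (p ++ u′ ++ v′ ++ s ≡ W)       ≡⟨ cong (λ x → p ++ x ≡ W) (++-assoc u′ v′ s) ⟨
    (p ++ (u′ ++ v′) ++ s ≡ W)     ∎
    where open import Relation.Binary.Reasoning.Setoid (⇔-setoid 0ℓ)

  monoid : Monoid 0ℓ 0ℓ
  monoid = record
    { Carrier  = Word
    ; _≈_      = _≈ᵂ_
    ; _∙_      = _++_
    ; ε        = []
    ; isMonoid = record
      { isSemigroup = record
        { isMagma = record
          { isEquivalence = record
            { refl  = λ p s → ⇔-refl
            ; sym   = λ u≈v p s → ⇔-sym (u≈v p s)
            ; trans = λ u≈v v≈w p s → ⇔-trans (u≈v p s) (v≈w p s)
            }
          ; ∙-cong = ++-cong
          }
        ; assoc = λ u v w → ≡⇒≈ᵂ (++-assoc u v w)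
        }
      ; identity = (λ u → ≡⇒≈ᵂ refl) , (λ u → ≡⇒≈ᵂ (++-identityʳ u))
      }
    }

  replace-factor : ∀ {u v} → B21⊨ u v → ∀ p s → p ++ u ++ s ≡ W → p ++ v ++ s ≡ W
  replace-factor {u} {v} u≈v p s refl =
    W-isoterm (p ++ v ++ s) (B21⊨-++ {p} {p} (λ _ → refl) (B21⊨-++ {u} {v} {s} {s} u≈v λ _ → refl))

  satisfies-B21 : ∀ u v → B21⊨ u v → monoid ⊨ u ≈ᵢ v
  satisfies-B21 u v u≈v θ p s =
    mk⇔ (replace-factor θu≈θv p s) (replace-factor (λ ψ → sym (θu≈θv ψ)) p s)
    where θu≈θv = B21⊨-substitute {u} {v} u≈v θ

  square-free : ∀ p u s → p ++ u ++ u ++ s ≡ W → u ≡ []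
  square-free p u s p·uu·s≡W = ++-identityˡ-unique u (sym (++-cancelˡ p _ _ p·uuu·s≡p·uu·s))
    where
    p·uuu·s≡p·uu·s : p ++ u ++ u ++ u ++ s ≡ p ++ u ++ u ++ s
    p·uuu·s≡p·uu·s = trans (W-isoterm _ λ ψ → trans (cong (evalB ψ) (sym p·uu·s≡W))
                                (B21⊨-++ {p} {p} (λ _ → refl) (B21⊨-square≈cube u s) ψ))
                           (sym p·uu·s≡W)

  satisfies-x²y≈yx² : monoid ⊨ (0 ∷ 0 ∷ 1 ∷ []) ≈ᵢ (1 ∷ 0 ∷ 0 ∷ [])
  satisfies-x²y≈yx² θ with θ 0 | θ 1
  ... | []         | t = ≡⇒≈ᵂ refl
  ... | u@(_ ∷ _)  | t = λ p s → mk⇔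
    (λ e → ⊥-elim (nonempty (square-free p u ((t ++ []) ++ s) (trans (sym (left p s)) e))))
    (λ e → ⊥-elim (nonempty (square-free (p ++ t) u s (trans (sym (right p s)) e))))
    where
    nonempty : u ≢ []
    nonempty ()
    left : ∀ p s → p ++ (u ++ u ++ t ++ []) ++ s ≡ p ++ u ++ u ++ (t ++ []) ++ s
    left p s = cong (p ++_) (trans (++-assoc u _ s) (cong (u ++_) (++-assoc u (t ++ []) s)))
    right : ∀ p s → p ++ (t ++ u ++ u ++ []) ++ s ≡ (p ++ t) ++ u ++ u ++ s
    right p s = trans (cong (p ++_) (trans (++-assoc t _ s)
                        (cong (t ++_) (trans (++-assoc u (u ++ []) s) (cong (u ++_) (++-assoc u [] s))))))
                      (sym (++-assoc p t (u ++ u ++ s)))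

  isoterm : IsIsoterm W
  isoterm w′ W≈w′ = begin
    w′                        ≡⟨ substitute-[ w′ ] ⟨
    substitute [_] w′         ≡⟨ ++-identityʳ _ ⟨
    substitute [_] w′ ++ []   ≡⟨ Equivalence.to (W≈[_]w′ [] []) W-in-context ⟩
    W                         ∎
    where
    open ≡-Reasoning
    W≈[_]w′ : substitute [_] W ≈ᵂ substitute [_] w′
    W≈[_]w′ = W≈w′ monoid (satisfies-B21 , satisfies-x²y≈yx²) [_]
    W-in-context : substitute [_] W ++ [] ≡ W
    W-in-context = trans (++-identityʳ _) substitute-[ W ]

module Separation {T : Set} (φ : T → ℕ → B21) (τ : T → B21) (τ≢zer : ∀ t → τ t ≢ zer) where

  Killed : (T → B21) → ℕ → Set
  Killed σ d = ∃ λ t → σ t · φ t d ≡ zer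

  Determines : (T → B21) → Word → Set
  Determines σ []      = (∀ t → σ t ≡ τ t) × (∀ d → Killed σ d)
  Determines σ (c ∷ w) = (∃ λ t → σ t ≢ τ t)
                       × (∀ d → d ≡ c ⊎ Killed σ d)
                       × Determines (λ t → σ t · φ t c) w

  determines-resp : ∀ {σ σ′} w → (∀ t → σ t ≡ σ′ t) → Determines σ w → Determines σ′ w
  determines-resp []      σ≗σ′ (final , killed) =
    (λ t → trans (sym (σ≗σ′ t)) (final t)) ,
    (λ d → map₂ (λ {t} → trans (cong (_· φ t d) (sym (σ≗σ′ t)))) (killed d))
  determines-resp (c ∷ w) σ≗σ′ ((t , σt≢τt) , next , rest) =
    (t , σt≢τt ∘ trans (σ≗σ′ t)) ,
    (λ d → ⊎-map₂ (map₂ (λ {t} → trans (cong (_· φ t d) (sym (σ≗σ′ t))))) (next d)) ,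
    determines-resp w (λ t → cong (_· φ t c) (σ≗σ′ t)) rest

  determines-run : ∀ {σ} w → Determines σ w → ∀ t → σ t · evalB (φ t) w ≡ τ t
  determines-run {σ} []      (final , _) t    = trans (·-identityʳ (σ t)) (final t)
  determines-run {σ} (c ∷ w) (_ , _ , rest) t =
    trans (sym (·-assoc (σ t) (φ t c) (evalB (φ t) w))) (determines-run w rest t)

  cannot-extend-killed : ∀ {σ d} → Killed σ d → ∀ v → ¬ (∀ t → σ t · evalB (φ t) (d ∷ v) ≡ τ t)
  cannot-extend-killed {σ} {d} (t , σt·d≡0) v σdv≡τ =
    τ≢zer t (trans (sym (σdv≡τ t)) (zer-propagates {σ t} {φ t d} σt·d≡0 (evalB (φ t) v)))

  determines-unique : ∀ {σ} w → Determines σ w → ∀ v → (∀ t → σ t · evalB (φ t) v ≡ τ t) → v ≡ w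
  determines-unique     []      _                  []      _    = refl
  determines-unique {σ} []      (_ , killed)       (d ∷ v) σv≡τ =
    ⊥-elim (cannot-extend-killed {σ} {d} (killed d) v σv≡τ)
  determines-unique     (c ∷ w) ((t , σt≢τt) , _) []      σv≡τ =
    ⊥-elim (σt≢τt (trans (sym (·-identityʳ _)) (σv≡τ t)))
  determines-unique {σ} (c ∷ w) (_ , next , rest)  (d ∷ v) σv≡τ with next d
  ... | inj₁ refl   = cong (c ∷_) (determines-unique w rest v λ t →
                        trans (·-assoc (σ t) (φ t c) (evalB (φ t) v)) (σv≡τ t))
  ... | inj₂ killed = ⊥-elim (cannot-extend-killed {σ} {d} killed v σv≡τ)

  isB21Isoterm : ∀ {σ} w → Determines σ w → IsB21Isoterm w
  isB21Isoterm {σ} w det v w≈v = determines-unique w det v λ t →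
    trans (cong (σ t ·_) (sym (w≈v (φ t)))) (determines-run w det t)

%-cong-+ʳ : ∀ m m′ k d .{{_ : NonZero d}} → m % d ≡ m′ % d → (m + k) % d ≡ (m′ + k) % d
%-cong-+ʳ m m′ k d m≡m′ = begin
  (m + k) % d                ≡⟨ %-distribˡ-+ m k d ⟩
  (m % d + k % d) % d        ≡⟨ cong (λ r → (r + k % d) % d) m≡m′ ⟩
  (m′ % d + k % d) % d       ≡⟨ %-distribˡ-+ m′ k d ⟨
  (m′ + k) % d               ∎
  where open ≡-Reasoning

suc-%-cong : ∀ m m′ d .{{_ : NonZero d}} → m % d ≡ m′ % d → suc m % d ≡ suc m′ % d
suc-%-cong m m′ d m≡m′ = begin
  suc m % d    ≡⟨ cong (_% d) (+-comm 1 m) ⟩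
  (m + 1) % d  ≡⟨ %-cong-+ʳ m m′ 1 d m≡m′ ⟩
  (m′ + 1) % d ≡⟨ cong (_% d) (+-comm m′ 1) ⟩
  suc m′ % d   ∎
  where open ≡-Reasoning

suc-%-injective : ∀ m m′ d .{{_ : NonZero d}} → suc m % d ≡ suc m′ % d → m % d ≡ m′ % d
suc-%-injective m m′ d sm≡sm′ = begin
  m % d                  ≡⟨ [m+n]%n≡m%n m d ⟨
  (m + d) % d            ≡⟨ cong (_% d) (shift m) ⟩
  (suc m + pred d) % d   ≡⟨ %-cong-+ʳ (suc m) (suc m′) (pred d) d sm≡sm′ ⟩
  (suc m′ + pred d) % d  ≡⟨ cong (_% d) (shift m′) ⟨
  (m′ + d) % d           ≡⟨ [m+n]%n≡m%n m′ d ⟩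
  m′ % d                 ∎
  where
  open ≡-Reasoning
  shift : ∀ m → m + d ≡ suc m + pred d
  shift m = trans (cong (m +_) (sym (suc-pred d))) (+-suc m (pred d))

suc-%-≢ : ∀ m d .{{_ : NonZero d}} → 2 ≤ d → suc m % d ≢ m % d
suc-%-≢ m d 2≤d sm≡m with m≤n⇒m<n∨m≡n (m%n<n m d)
... | inj₁ 1+r<d = 1+n≢n (begin
  suc (m % d)         ≡⟨ m<n⇒m%n≡m 1+r<d ⟨
  suc (m % d) % d     ≡⟨ suc-%-cong (m % d) m d (m%n%n≡m%n m d) ⟩
  suc m % d           ≡⟨ sm≡m ⟩
  m % d               ∎)
  where open ≡-Reasoning
... | inj₂ 1+r≡d = <⇒≢ 2≤d (sym (begin
  d                   ≡⟨ 1+r≡d ⟨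
  suc (m % d)         ≡⟨ cong suc (begin
    m % d               ≡⟨ sm≡m ⟨
    suc m % d           ≡⟨ suc-%-cong (m % d) m d (m%n%n≡m%n m d) ⟨
    suc (m % d) % d     ≡⟨ cong (_% d) 1+r≡d ⟩
    d % d               ≡⟨ n%n≡0 d ⟩
    0                   ∎) ⟩
  1                   ∎))
  where open ≡-Reasoning

[m+d]%d≡m : ∀ {m d} .{{_ : NonZero d}} → m < d → (m + d) % d ≡ m
[m+d]%d≡m {m} {d} m<d = trans ([m+n]%n≡m%n m d) (m<n⇒m%n≡m m<d)

d+m<2d⇒m<d : ∀ {m d} → d + m < 2 * d → m < d
d+m<2d⇒m<d {m} {d} d+m<2d = +-cancelˡ-< d m d (subst (d + m <_) (cong (d +_) (+-identityʳ d)) d+m<2d)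

m%d≡0⇒m≡d : ∀ {m d} .{{_ : NonZero d}} → 0 < m → m < 2 * d → m % d ≡ 0 → m ≡ d
m%d≡0⇒m≡d {m} {d} 0<m m<2d m%d≡0 with m <? d
... | yes m<d = contradiction (trans (sym (m<n⇒m%n≡m m<d)) m%d≡0) (≢-sym (<⇒≢ 0<m))
... | no  m≮d with m≤n⇒∃[o]m+o≡n (≮⇒≥ m≮d)
...   | j , refl = trans (cong (d +_) j≡0) (+-identityʳ d)
  where
  j≡0 : j ≡ 0
  j≡0 = begin
    j             ≡⟨ [m+d]%d≡m (d+m<2d⇒m<d m<2d) ⟨
    (j + d) % d   ≡⟨ cong (_% d) (+-comm j d) ⟩
    (d + j) % d   ≡⟨ m%d≡0 ⟩
    0             ∎
    where open ≡-Reasoning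

odd?-suc : ∀ m → odd? (suc m) ≡ not (odd? m)
odd?-suc m with odd? m
... | true  = refl
... | false = refl

odd?-2* : ∀ m → odd? (2 * m) ≡ false
odd?-2* zero    = refl
odd?-2* (suc m) = begin
  odd? (2 * suc m)             ≡⟨ cong odd? (*-suc 2 m) ⟩
  odd? (suc (suc (2 * m)))     ≡⟨ odd?-suc (suc (2 * m)) ⟩
  not (odd? (suc (2 * m)))     ≡⟨ cong not (odd?-suc (2 * m)) ⟩
  not (not (odd? (2 * m)))     ≡⟨ not-involutive _ ⟩
  odd? (2 * m)                 ≡⟨ odd?-2* m ⟩
  false                        ∎
  where open ≡-Reasoning

-- Unlike if does d, this stays a function of d itself: for ℕ, does (m ≟ n)
-- unfolds to m ≡ᵇ n, and with-abstraction on m ≟ n would no longer find it.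
ifᴰ_then_else_ : {P : Set} {A : Set} → Dec P → A → A → A
ifᴰ yes _ then x else _ = x
ifᴰ no  _ then _ else y = y

module Wn (k : ℕ) (3≤n : 3 ≤ suc (2 * k)) where

  n N : ℕ
  n = suc (2 * k)
  N = 2 * n ∸ 1

  2≤n : 2 ≤ n
  2≤n = ≤-trans (n≤1+n 2) 3≤n

  +-suc≡N⇒< : ∀ {q f} → q + suc f ≡ N → q < N
  +-suc≡N⇒< {q} q+1+f≡N = subst (q <_) q+1+f≡N (m<m+n q (s≤s z≤n))

  -- Counting from 0, the q-th x-letter of w_n is X_q = x_{q mod n + 1},
  -- followed for q < N by S_q = s_{q+1}. A test in state ba awaits a letter
  -- it sends to b; in state b, one it sends to a.
  letterX letterS : ℕ → ℕ
  letterX q = xL (suc (q % n))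
  letterS q = if odd? q then zL else yL

  suffixX suffixS : ℕ → ℕ → Word
  suffixX q f       = letterX q ∷ suffixS q f
  suffixS q zero    = []
  suffixS q (suc f) = letterS q ∷ suffixX (suc q) f

  data Test : Set where
    kind spacer : Test
    pair        : ℕ → Test

  wrap : Test
  wrap = pair (2 * k)

  φ : Test → ℕ → B21
  φ kind     0             = a
  φ kind     1             = a
  φ kind     (suc (suc i)) = ifᴰ i <? n then b else zer
  φ spacer   0             = a
  φ spacer   1             = b
  φ spacer   (suc (suc i)) = one
  φ (pair p) 0             = one
  φ (pair p) 1             = ifᴰ suc p % n ≟ 0 then ab else one
  φ (pair p) (suc (suc i)) = ifᴰ i ≟ suc p % n then b else ifᴰ i ≟ p % n then a else one

  awaitB : Bool → B21
  awaitB true  = ba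
  awaitB false = b

  pairState : ℕ → ℕ → B21
  pairState ν p = ifᴰ ν % n ≟ suc p % n then ba else b

  awaitB≢zer : ∀ e → awaitB e ≢ zer
  awaitB≢zer true  ()
  awaitB≢zer false ()

  pairState≢zer : ∀ ν p → pairState ν p ≢ zer
  pairState≢zer ν p with ν % n ≟ suc p % n
  ... | yes _ = λ ()
  ... | no  _ = λ ()

  stateX stateS : ℕ → Test → B21
  stateX q kind     = ba
  stateX q spacer   = awaitB (odd? q)
  stateX q (pair p) = pairState q p
  stateS q kind     = b
  stateS q spacer   = awaitB (odd? q)
  stateS q (pair p) = pairState (suc q) p

  stepX : ∀ q t → stateX q t · φ t (letterX q) ≡ stateS q t
  stepX q kind with q % n <? n
  ... | yes _   = refl
  ... | no  r≮n = contradiction (m%n<n q n) r≮n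
  stepX q spacer = ·-identityʳ _
  stepX q (pair p) with q % n ≟ suc p % n | q % n ≟ p % n | suc q % n ≟ suc p % n
  ... | yes r≡1+p | _       | yes 1+q≡1+p =
    contradiction (trans (sym r≡1+p) (suc-%-injective q p n 1+q≡1+p)) (suc-%-≢ p n 2≤n)
  ... | yes _     | _       | no  _       = refl
  ... | no  _     | yes _   | yes _       = refl
  ... | no  _     | yes r≡p | no  1+q≢1+p = contradiction (suc-%-cong q p n r≡p) 1+q≢1+p
  ... | no  _     | no  r≢p | yes 1+q≡1+p = contradiction (suc-%-injective q p n 1+q≡1+p) r≢p
  ... | no  _     | no  _   | no  _       = refl

  -- The only use of n being odd: z sits at odd q, while suc q ≡ n forces q ≡ 2k.
  wrap-absent-before-z : ∀ {q} → odd? q ≡ true → q < N → suc q % n ≢ 0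
  wrap-absent-before-z {q} q-odd q<N 1+q%n≡0 with m%d≡0⇒m≡d (s≤s z≤n) (s≤s q<N) 1+q%n≡0
  ... | refl = contradiction (trans (sym q-odd) (odd?-2* k)) λ ()

  stepS : ∀ q t → q < N → stateS q t · φ t (letterS q) ≡ stateX (suc q) t
  stepS q kind _ with odd? q
  ... | true  = refl
  ... | false = refl
  stepS q spacer _ rewrite odd?-suc q with odd? q
  ... | true  = refl
  ... | false = refl
  stepS q (pair p) q<N with odd? q in q-odd
  ... | false = ·-identityʳ _
  ... | true with suc p % n ≟ 0
  ...   | no _ = ·-identityʳ _
  ...   | yes 1+p%n≡0 with suc q % n ≟ suc p % n
  ...     | yes 1+q≡1+p = contradiction (trans 1+q≡1+p 1+p%n≡0) (wrap-absent-before-z q-odd q<N)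
  ...     | no  _       = refl

  τ : Test → B21
  τ = stateS N

  τ≢zer : ∀ t → τ t ≢ zer
  τ≢zer kind     ()
  τ≢zer spacer   = awaitB≢zer (odd? N)
  τ≢zer (pair p) = pairState≢zer (suc N) p

  open Separation φ τ τ≢zer

  kind-rejects-x : ∀ i → b · φ kind (xL (suc i)) ≡ zer
  kind-rejects-x i with i <? n
  ... | yes _ = refl
  ... | no  _ = refl

  kind-rejects-foreign : ∀ {i} → ¬ i < n → φ kind (xL (suc i)) ≡ zer
  kind-rejects-foreign {i} i≮n with i <? n
  ... | yes i<n = contradiction i<n i≮n
  ... | no  _   = refl

  b-letter-of-predecessor : ∀ {i} → i < n → suc (i + 2 * k) % n ≡ i
  b-letter-of-predecessor {i} i<n = trans (cong (_% n) (sym (+-suc i (2 * k)))) ([m+d]%d≡m i<n)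

  killX : ∀ q d → d ≡ letterX q ⊎ Killed (stateX q) d
  killX q 0 = inj₂ (kind , refl)
  killX q 1 = inj₂ (kind , refl)
  killX q (suc (suc i)) with i <? n
  ... | no  i≮n = inj₂ (kind , cong (ba ·_) (kind-rejects-foreign i≮n))
  ... | yes i<n with i ≟ q % n
  ...   | yes refl = inj₁ refl
  ...   | no  i≢r  = inj₂ (pair (i + 2 * k) , killed)
    where
    killed : pairState q (i + 2 * k) · φ (pair (i + 2 * k)) (xL (suc i)) ≡ zer
    killed rewrite b-letter-of-predecessor i<n with q % n ≟ i | i ≟ i
    ... | yes r≡i | _      = contradiction (sym r≡i) i≢r
    ... | no  _   | yes _  = refl
    ... | no  _   | no i≢i = contradiction refl i≢i

  killS : ∀ q d → d ≡ letterS q ⊎ Killed (stateS q) d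
  killS q 0 with odd? q in q-odd
  ... | true  = inj₂ (spacer , cong (λ e → awaitB e · a) q-odd)
  ... | false = inj₁ refl
  killS q 1 with odd? q in q-odd
  ... | true  = inj₁ refl
  ... | false = inj₂ (spacer , cong (λ e → awaitB e · b) q-odd)
  killS q (suc (suc i)) = inj₂ (kind , kind-rejects-x i)

  odd?-N : odd? N ≡ true
  odd?-N = trans (sym (not-involutive (odd? N))) (cong not (trans (sym (odd?-suc N)) (odd?-2* n)))

  τ-spacer : τ spacer ≡ ba
  τ-spacer = cong awaitB odd?-N

  wrap-b-letter : suc (2 * k) % n ≡ 0
  wrap-b-letter = n%n≡0 n

  end-is-wrap : suc N % n ≡ 0
  end-is-wrap = m*n%n≡0 2 n

  τ-wrap : τ wrap ≡ ba
  τ-wrap rewrite wrap-b-letter | end-is-wrap = refl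

  wrap-before-z : ∀ {q} → odd? q ≡ true → q < N → stateS q wrap ≡ b
  wrap-before-z {q} q-odd q<N rewrite wrap-b-letter with suc q % n ≟ 0
  ... | yes 1+q%n≡0 = contradiction 1+q%n≡0 (wrap-absent-before-z q-odd q<N)
  ... | no  _       = refl

  φ-wrap-z : φ wrap zL ≡ ab
  φ-wrap-z rewrite wrap-b-letter = refl

  killEnd : ∀ d → Killed τ d
  killEnd 0             = spacer , cong (_· a) τ-spacer
  killEnd 1             = wrap , cong₂ _·_ τ-wrap φ-wrap-z
  killEnd (suc (suc i)) = kind , kind-rejects-x i

  distinguishedX : ∀ q → ∃ λ t → stateX q t ≢ τ t
  distinguishedX q = kind , λ ()

  distinct-states : ∀ {x y} → x ≡ b → y ≡ ba → x ≢ y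
  distinct-states refl refl ()

  distinguishedS : ∀ {q} → q < N → ∃ λ t → stateS q t ≢ τ t
  distinguishedS {q} q<N with odd? q in q-odd
  ... | false = spacer , distinct-states (cong awaitB q-odd) τ-spacer
  ... | true  = wrap , distinct-states (wrap-before-z q-odd q<N) τ-wrap

  determinesX : ∀ q f → q + f ≡ N → Determines (stateX q) (suffixX q f)
  determinesS : ∀ q f → q + f ≡ N → Determines (stateS q) (suffixS q f)

  determinesX q f q+f≡N =
    distinguishedX q , killX q ,
    determines-resp (suffixS q f) (λ t → sym (stepX q t)) (determinesS q f q+f≡N)

  determinesS q zero q+0≡N =
    subst (λ m → Determines (stateS m) []) (trans (sym q+0≡N) (+-identityʳ q)) ((λ t → refl) , killEnd)
  determinesS q (suc f) q+1+f≡N =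
    distinguishedS q<N , killS q ,
    determines-resp (suffixX (suc q) f) (λ t → sym (stepS q t q<N))
                    (determinesX (suc q) f (trans (sym (+-suc q f)) q+1+f≡N))
    where
    q<N : q < N
    q<N = +-suc≡N⇒< q+1+f≡N

  -- Copies of the where-block of wn, so that wn n unfolds to concat (map block …).
  idx : ℕ → ℕ
  idx j = if j ≤ᵇ n then j else j ∸ n

  block : ℕ → Word
  block j = xL (idx j) ∷ sL j ∷ []

  idx-suc : ∀ {q} → q < 2 * n → idx (suc q) ≡ suc (q % n)
  idx-suc {q} q<2n with suc q ≤ᵇ n | ≤ᵇ-reflects-≤ (suc q) n
  ... | true  | ofʸ q<n = cong suc (sym (m<n⇒m%n≡m q<n))
  ... | false | ofⁿ q≮n with m≤n⇒∃[o]m+o≡n (≤-pred (≰⇒> q≮n))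
  ...   | j , refl = begin
    suc (n + j) ∸ n  ≡⟨ cong (_∸ n) (+-suc n j) ⟨
    n + suc j ∸ n    ≡⟨ m+n∸m≡n n (suc j) ⟩
    suc j            ≡⟨ cong suc (trans (cong (_% n) (+-comm n j)) ([m+d]%d≡m (d+m<2d⇒m<d q<2n))) ⟨
    suc ((n + j) % n) ∎
    where open ≡-Reasoning

  sL-suc : ∀ q → sL (suc q) ≡ letterS q
  sL-suc q rewrite odd?-suc q with odd? q
  ... | true  = refl
  ... | false = refl

  last-letter : letterX N ≡ xL n
  last-letter = cong xL (trans (sym (idx-suc ≤-refl)) idx-2n)
    where
    idx-2n : idx (2 * n) ≡ n
    idx-2n with 2 * n ≤ᵇ n | ≤ᵇ-reflects-≤ (2 * n) n
    ... | true  | ofʸ 2n≤n = contradiction 2n≤n (<⇒≱ (m<m+n n (s≤s z≤n)))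
    ... | false | ofⁿ _    = trans (m+n∸m≡n n (n + 0)) (+-identityʳ n)

  blocks≡suffix : ∀ f q (g : ℕ → ℕ) → (∀ i → g i ≡ suc (q + i)) → q + f ≡ N →
                  concat (map block (applyUpTo g f)) ++ xL n ∷ [] ≡ suffixX q f
  blocks≡suffix zero q g _ q+0≡N =
    cong (_∷ []) (trans (sym last-letter) (cong letterX (trans (sym q+0≡N) (+-identityʳ q))))
  blocks≡suffix (suc f) q g g≗ q+1+f≡N rewrite g≗ 0 | +-identityʳ q =
    cong₂ _∷_ (cong xL (idx-suc (m<n⇒m<1+n q<N)))
      (cong₂ _∷_ (sL-suc q)
        (blocks≡suffix f (suc q) (g ∘ suc) (λ i → trans (g≗ (suc i)) (cong suc (+-suc q i)))
                       (trans (sym (+-suc q f)) q+1+f≡N)))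
    where
    q<N : q < N
    q<N = +-suc≡N⇒< q+1+f≡N

  wn≡suffix : wn n ≡ suffixX 0 N
  wn≡suffix = blocks≡suffix N 0 suc (λ i → refl) refl

  wn-isB21Isoterm : IsB21Isoterm (wn n)
  wn-isB21Isoterm = subst IsB21Isoterm (sym wn≡suffix) (isB21Isoterm (suffixX 0 N) (determinesX 0 N refl))

lemma4p4 : ∀ (n : ℕ) → 3 ≤ n → Odd n → IsIsoterm (wn n)
lemma4p4 n 3≤n (k , refl) = Syntactic.isoterm (wn n) (Wn.wn-isB21Isoterm k 3≤n)
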